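{- Let $r$ be a positive integer. For all fixed integers $k \ge r$ and $c \ge 2$, $ex_k(m, P_{r,c}) = \Theta(m^r)$ as $m\to\infty$ (with constants depending on $r,k,c$).
   Context: $P_{r,c}$ denotes the $r\times c$ matrix all of whose entries are one. A $0-1$ matrix $A$ contains a $0-1$ matrix $M$ if some submatrix of $A$ can be transformed into $M$ by changing some ones to zeroes; otherwise $A$ avoids $M$. $ex_k(m,P)$ is the maximum number of columns in a $0-1$ matrix with $m$ rows that avoids $P$ and has at least $k$ ones in every column. -}

module Defs where

open import Data.Nat using (ℕ; zero; suc; _+_; _*_; _^_; _≤_; _<_; _≥_)
open import Data.Bool using (Bool; true; false; if_then_else_)
open import Data.Fin using (Fin; toℕ)
open import Data.List using (List; map; allFin)
open import Data.Nat.ListAction using (sum)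
open import Data.Empty using (⊥)
open import Data.Product using (Σ; ∃; _×_; _,_)
open import Relation.Binary.PropositionalEquality using (_≡_)

-- A 0-1 matrix with m rows and n columns; true = 1, false = 0.
Matrix01 : ℕ → ℕ → Set
Matrix01 m n = Fin m → Fin n → Bool

P : (r c : ℕ) → Matrix01 r c
P r c _ _ = true

StrictlyIncreasing : {a b : ℕ} → (Fin a → Fin b) → Set
StrictlyIncreasing {a} f = (i j : Fin a) → toℕ i < toℕ j → toℕ (f i) < toℕ (f j)

-- A contains M: some submatrix of A (rows f, columns g, order preserved)
-- can be turned into M by changing some ones to zeroes, i.e. every one of M
-- sits at a one of the submatrix.
Contains : {m n r c : ℕ} → Matrix01 m n → Matrix01 r c → Set
Contains {m} {n} {r} {c} A M =
  Σ (Fin r → Fin m) λ f → Σ (Fin c → Fin n) λ g →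
    StrictlyIncreasing f × StrictlyIncreasing g ×
    ((i : Fin r) (j : Fin c) → M i j ≡ true → A (f i) (g j) ≡ true)

Avoids : {m n r c : ℕ} → Matrix01 m n → Matrix01 r c → Set
Avoids A M = Contains A M → ⊥

colOnes : {m n : ℕ} → Matrix01 m n → Fin n → ℕ
colOnes {m} A j = sum (map (λ i → if A i j then 1 else 0) (allFin m))

Admissible : (k : ℕ) {m n r c : ℕ} → Matrix01 m n → Matrix01 r c → Set
Admissible k {n = n} A M = Avoids A M × ((j : Fin n) → k ≤ colOnes A j)

-- ex_k(m, M) = e : e is the maximum number of columns of an admissible matrix
-- with m rows (attained, and an upper bound for all admissible matrices).
IsEx : (k m : ℕ) {r c : ℕ} → Matrix01 r c → ℕ → Set
IsEx k m M e =
  Σ (Matrix01 m e) (λ A → Admissible k A M) ×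
  ((n : ℕ) (A : Matrix01 m n) → Admissible k A M → n ≤ e)

module Submission where

-- Upper bound (width-bound): every column has k ≥ r ones; the positions of its
-- first r ones form one of m ^ r signatures.  With more than (c-1) · m ^ r
-- columns the generalized pigeonhole principle (double counting) gives c
-- columns with equal signature, i.e. a copy of P_{r,c}.
-- Lower bound (PolynomialCode): cut the rows into k blocks of size S; column a,
-- a polynomial with r coefficients in [0, q), has its one of block t at offset
-- a(t).  Distinct polynomials agree in fewer than r points (synthetic division
-- over ℤ), so no two columns share r ones; q = m / k ^ (r+1) gives q ^ r columns.
-- Existence of the maximum: containment and admissibility are decidable by
-- exhaustive search over finite function spaces, so the nonempty, bounded set
-- of admissible widths has a greatest element.
-- Sections: counting and pigeonhole, upper bound, search for the maximum,
-- polynomials, the code, and the theorem.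

open import Defs
open import Data.Bool using (Bool; true; false; if_then_else_)
import Data.Bool.Properties as Boolₚ
open import Data.Fin as Fin using (Fin; zero; suc; toℕ; fromℕ<; punchOut; combine; funToFin; finToFun)
open import Data.Fin.Properties
  using (toℕ-injective; toℕ<n; toℕ-fromℕ<; 0≢1+n; suc-injective; punchIn-punchOut; any?; all?;
         finToFun-funToFin; funToFin-finToFin)
open import Data.Integer as ℤ using (ℤ; +_; 0ℤ)
import Data.Integer.Properties as ℤ
open import Data.Integer.Tactic.RingSolver using (solve-∀)
open import Data.List using (map; tabulate; allFin)
open import Data.List.Properties using (map-cong)
open import Data.Nat as ℕ
  using (ℕ; zero; suc; _+_; _*_; _^_; _≤_; _<_; _≥_; _≤?_; _<?_; z≤n; s≤s; s≤s⁻¹; z<s;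
         NonZero; >-nonZero; >-nonZero⁻¹)
open import Data.Nat.DivMod
open import Data.Nat.Divisibility using (n∣m*n)
open import Data.Nat.ListAction using (sum)
open import Data.Nat.Properties hiding (_≟_; suc-injective; 0≢1+n)
open import Algebra.Properties.CommutativeMonoid.Sum +-0-commutativeMonoid using (sum-syntax; ∑-comm)
open import Algebra.Properties.CommutativeSemigroup *-commutativeSemigroup using (x∙yz≈y∙xz)
import Data.Nat.Tactic.RingSolver as ℕ-Solver
open import Data.Product using (Σ; _×_; _,_; proj₁; proj₂)
open import Data.Sum using (inj₁; inj₂)
open import Data.Vec.Functional using (_∷_)
open import Function using (_∘_; Injective)
open import Relation.Binary.Definitions using (tri<; tri≈; tri>)
open import Relation.Binary.PropositionalEquality
open import Relation.Nullary using (Dec; yes; no; does; contradiction)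
open import Relation.Nullary.Decidable using (dec-true; ¬?; _×-dec_; _→-dec_)

private
  variable
    k m n r K c : ℕ

sound : ∀ {A : Set} (a? : Dec A) → does a? ≡ true → A
sound (yes a) _ = a

bit : Bool → ℕ
bit b = if b then 1 else 0

count : (Fin m → Bool) → ℕ
count {m} v = ∑[ i < m ] bit (v i)

sum-map-tabulate : ∀ {A : Set} (g : A → ℕ) (h : Fin n → A) →
  sum (map g (tabulate h)) ≡ ∑[ i < n ] g (h i)
sum-map-tabulate {zero}  g h = refl
sum-map-tabulate {suc n} g h = cong (λ s → g (h zero) + s) (sum-map-tabulate g (h ∘ suc))

colOnes≡count : (A : Matrix01 m n) (j : Fin n) → colOnes A j ≡ count (λ i → A i j)
colOnes≡count A j = sum-map-tabulate (λ i → bit (A i j)) (λ i → i)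

∑-const : ∀ n c → ∑[ i < n ] c ≡ n * c
∑-const zero    c = refl
∑-const (suc n) c = cong (λ s → c + s) (∑-const n c)

∑-mono-≤ : (f g : Fin n → ℕ) → (∀ i → f i ≤ g i) → ∑[ i < n ] f i ≤ ∑[ i < n ] g i
∑-mono-≤ {zero}  f g f≤g = z≤n
∑-mono-≤ {suc n} f g f≤g = +-mono-≤ (f≤g zero) (∑-mono-≤ (f ∘ suc) (g ∘ suc) (f≤g ∘ suc))

∑-term : (f : Fin n → ℕ) (i : Fin n) → f i ≤ ∑[ j < n ] f j
∑-term f zero    = m≤m+n _ _
∑-term f (suc i) = ≤-trans (∑-term (f ∘ suc) i) (m≤n+m _ _)

increasing-injective : (f : Fin k → Fin m) → StrictlyIncreasing f →
  ∀ s s' → toℕ (f s) ≡ toℕ (f s') → s ≡ s'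
increasing-injective f f↑ s s' eq with <-cmp (toℕ s) (toℕ s')
... | tri< s<s' _ _ = contradiction eq (<⇒≢ (f↑ s s' s<s'))
... | tri≈ _ s≡s' _ = toℕ-injective s≡s'
... | tri> _ _ s>s' = contradiction (sym eq) (<⇒≢ (f↑ s' s s>s'))

increasing-suc : (f : Fin k → Fin m) → StrictlyIncreasing f → StrictlyIncreasing (suc ∘ f)
increasing-suc f f↑ i j i<j = s≤s (f↑ i j i<j)

increasing-cons-zero : (f : Fin k → Fin m) → StrictlyIncreasing f →
  StrictlyIncreasing {b = suc m} (zero ∷ suc ∘ f)
increasing-cons-zero f f↑ zero    (suc j) _         = z<s
increasing-cons-zero f f↑ (suc i) (suc j) (s≤s i<j) = s≤s (f↑ i j i<j)

shiftDown : (f : Fin k → Fin (suc m)) → (∀ i → zero ≢ f i) → Fin k → Fin m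
shiftDown f f≢0 i = punchOut (f≢0 i)

increasing-shiftDown : (f : Fin k → Fin (suc m)) (f≢0 : ∀ i → zero ≢ f i) →
  StrictlyIncreasing f → StrictlyIncreasing (shiftDown f f≢0)
increasing-shiftDown f f≢0 f↑ i j i<j =
  s≤s⁻¹ (subst₂ (λ x y → toℕ x < toℕ y)
    (sym (punchIn-punchOut (f≢0 i))) (sym (punchIn-punchOut (f≢0 j))) (f↑ i j i<j))

positive⇒≢zero : {y : Fin (suc m)} → 0 < toℕ y → zero ≢ y
positive⇒≢zero 0<y refl = <-irrefl refl 0<y

chooseOnes : (v : Fin m → Bool) → r ≤ count v →
  Σ (Fin r → Fin m) λ f → StrictlyIncreasing f × (∀ i → v (f i) ≡ true)
chooseOnes {zero} {zero} v _ = (λ ()) , (λ ()) , (λ ())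
chooseOnes {suc m} {r} v r≤ with v zero in v₀
... | false = let (f , f↑ , ones) = chooseOnes (v ∘ suc) r≤ in
              suc ∘ f , increasing-suc f f↑ , ones
chooseOnes {suc m} {zero}  v _         | true = (λ ()) , (λ ()) , (λ ())
chooseOnes {suc m} {suc r} v (s≤s r≤) | true =
  let (f , f↑ , ones) = chooseOnes (v ∘ suc) r≤ in
  zero ∷ suc ∘ f , increasing-cons-zero f f↑ , λ { zero → v₀ ; (suc i) → ones i }

count-≥ : (v : Fin m → Bool) (f : Fin k → Fin m) → StrictlyIncreasing f →
  (∀ i → v (f i) ≡ true) → k ≤ count v
count-≥ {k = zero} v f f↑ ones = z≤n
count-≥ {zero} {suc k} v f f↑ ones with f zero
... | ()
count-≥ {suc m} {suc k} v f f↑ ones with f zero in f₀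
... | zero = subst (λ b → suc k ≤ bit b + count (v ∘ suc)) (sym v₀)
               (s≤s (count-≥ (v ∘ suc) (shiftDown g g≢0) (increasing-shiftDown g g≢0 g↑) g-ones))
  where
  v₀ : v zero ≡ true
  v₀ = trans (cong v (sym f₀)) (ones zero)
  g : Fin k → Fin (suc m)
  g = f ∘ suc
  g↑ : StrictlyIncreasing g
  g↑ i j i<j = f↑ (suc i) (suc j) (s≤s i<j)
  g≢0 : ∀ i → zero ≢ g i
  g≢0 i = positive⇒≢zero (subst (λ x → toℕ x < toℕ (g i)) f₀ (f↑ zero (suc i) z<s))
  g-ones : ∀ i → v (suc (shiftDown g g≢0 i)) ≡ true
  g-ones i = trans (cong v (punchIn-punchOut (g≢0 i))) (ones (suc i))
... | suc _ = ≤-trans (count-≥ (v ∘ suc) (shiftDown f f≢0) (increasing-shiftDown f f≢0 f↑) f-ones)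
                (m≤n+m _ _)
  where
  f≢0 : ∀ i → zero ≢ f i
  f≢0 zero    = positive⇒≢zero (subst (λ x → 0 < toℕ x) (sym f₀) z<s)
  f≢0 (suc i) = positive⇒≢zero (≤-<-trans z≤n (f↑ zero (suc i) z<s))
  f-ones : ∀ i → v (suc (shiftDown f f≢0 i)) ≡ true
  f-ones i = trans (cong v (punchIn-punchOut (f≢0 i))) (ones i)

inBox : (box : Fin n → Fin K) → Fin K → Fin n → Bool
inBox box y j = does (box j Fin.≟ y)

-- Double counting: every item lies in (at least) its own box.
items≤∑boxes : (box : Fin n → Fin K) → n ≤ ∑[ y < K ] count (inBox box y)
items≤∑boxes {n} {K} box = begin
  n                                              ≡⟨ sym (trans (∑-const n 1) (*-identityʳ n)) ⟩
  ∑[ j < n ] 1                                   ≤⟨ ∑-mono-≤ _ _ own-box ⟩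
  ∑[ j < n ] ∑[ y < K ] bit (inBox box y j)      ≡⟨ ∑-comm (λ j y → bit (inBox box y j)) ⟩
  ∑[ y < K ] count (inBox box y)                 ∎
  where
  open ≤-Reasoning
  own-box : ∀ j → 1 ≤ ∑[ y < K ] bit (inBox box y j)
  own-box j = subst (λ b → bit b ≤ ∑[ y < K ] bit (inBox box y j)) (dec-true (box j Fin.≟ box j) refl)
                (∑-term (λ y → bit (inBox box y j)) (box j))

pigeonhole : (box : Fin n → Fin K) → c * K < n →
  Σ (Fin K) λ y → Σ (Fin (suc c) → Fin n) λ g →
    StrictlyIncreasing g × (∀ i → box (g i) ≡ y)
pigeonhole {n} {K} {c} box cK<n with any? (λ y → suc c ≤? count (inBox box y))
... | yes (y , full) =
  let (g , g↑ , inside) = chooseOnes (inBox box y) full in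
  y , g , g↑ , λ i → sound (box (g i) Fin.≟ y) (inside i)
... | no no-full-box = contradiction n≤cK (<⇒≱ cK<n)
  where
  n≤cK : n ≤ c * K
  n≤cK = begin
    n                                ≤⟨ items≤∑boxes box ⟩
    ∑[ y < K ] count (inBox box y)   ≤⟨ ∑-mono-≤ _ _ (λ y → ≮⇒≥ (λ full → no-full-box (y , full))) ⟩
    ∑[ y < K ] c                     ≡⟨ trans (∑-const K c) (*-comm K c) ⟩
    c * K                            ∎
    where open ≤-Reasoning

funToFin-injective : (f f' : Fin r → Fin m) → funToFin f ≡ funToFin f' → ∀ i → f i ≡ f' i
funToFin-injective f f' eq i = begin
  f i                        ≡⟨ sym (finToFun-funToFin f i) ⟩
  finToFun (funToFin f) i    ≡⟨ cong (λ x → finToFun x i) eq ⟩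
  finToFun (funToFin f') i   ≡⟨ finToFun-funToFin f' i ⟩
  f' i                       ∎
  where open ≡-Reasoning

-- Otherwise,
-- by pigeonhole c+1 columns have the same first r ones, forming a copy of P.
width-bound : r ≤ k → (A : Matrix01 m n) → Admissible k A (P r (suc c)) → n ≤ c * m ^ r
width-bound {r} {k} {m} {n} {c} r≤k A (avoids , tall) with n ≤? c * m ^ r
... | yes n≤ = n≤
... | no n≰ = contradiction (copyOfP (pigeonhole signature (≰⇒> n≰))) avoids
  where
  firstRows : ∀ j → Σ (Fin r → Fin m) λ f → StrictlyIncreasing f × (∀ i → A (f i) j ≡ true)
  firstRows j = chooseOnes (λ i → A i j) (≤-trans r≤k (subst (k ≤_) (colOnes≡count A j) (tall j)))

  signature : Fin n → Fin (m ^ r)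
  signature j = funToFin (proj₁ (firstRows j))

  copyOfP : (Σ (Fin (m ^ r)) λ y → Σ (Fin (suc c) → Fin n) λ g →
               StrictlyIncreasing g × (∀ j → signature (g j) ≡ y)) →
            Contains A (P r (suc c))
  copyOfP (y , g , g↑ , same) = proj₁ (firstRows (g zero)) , g , proj₁ (proj₂ (firstRows (g zero))) , g↑ , ones
    where
    ones : ∀ i j → P r (suc c) i j ≡ true → A (proj₁ (firstRows (g zero)) i) (g j) ≡ true
    ones i j _ = subst (λ ρ → A ρ (g j) ≡ true)
      (funToFin-injective _ _ (trans (same j) (sym (same zero))) i)
      (proj₂ (proj₂ (firstRows (g j))) i)

-- Searching is how
-- we decide, for each number of columns, whether an admissible matrix exists.
Searchable : (A : Set) → (A → A → Set) → Set₁
Searchable A _≈_ = (Q : A → Set) → (∀ x → Dec (Q x)) → (∀ {x y} → x ≈ y → Q x → Q y) → Dec (Σ A Q)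

-- Functions are compared pointwise (there is no function extensionality).
Pointwise : {A : Set} → (A → A → Set) → (Fin n → A) → (Fin n → A) → Set
Pointwise _≈_ f g = ∀ i → f i ≈ g i

Bool-searchable : Searchable Bool _≡_
Bool-searchable Q Q? _ with Q? true | Q? false
... | yes q | _     = yes (true , q)
... | no _  | yes q = yes (false , q)
... | no ¬t | no ¬f = no λ { (true , q) → ¬t q ; (false , q) → ¬f q }

Fin-searchable : Searchable (Fin n) _≡_
Fin-searchable Q Q? _ = any? Q?

Π-searchable : {A : Set} {_≈_ : A → A → Set} → (∀ x → x ≈ x) →
  Searchable A _≈_ → Searchable (Fin n → A) (Pointwise _≈_)
Π-searchable {zero} refl≈ search Q Q? resp with Q? (λ ())
... | yes q = yes ((λ ()) , q)
... | no ¬q = no λ (f , q) → ¬q (resp (λ ()) q)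
Π-searchable {suc n} {A} {_≈_} refl≈ search Q Q? resp
  with search (λ a → Σ (Fin n → A) λ f → Q (a ∷ f))
         (λ a → Π-searchable refl≈ search (λ f → Q (a ∷ f)) (λ f → Q? (a ∷ f))
                  (λ f≈g → resp λ { zero → refl≈ a ; (suc i) → f≈g i }))
         (λ a≈b (f , q) → f , resp (λ { zero → a≈b ; (suc i) → refl≈ (f i) }) q)
... | yes (a , f , q) = yes (a ∷ f , q)
... | no ¬q = no λ (f , q) → ¬q (f zero , f ∘ suc , resp (λ { zero → refl≈ (f zero) ; (suc i) → refl≈ (f (suc i)) }) q)

increasing? : (f : Fin k → Fin m) → Dec (StrictlyIncreasing f)
increasing? f = all? λ i → all? λ j → (toℕ i <? toℕ j) →-dec (toℕ (f i) <? toℕ (f j))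

increasing-resp : {f g : Fin k → Fin m} → Pointwise _≡_ f g → StrictlyIncreasing f → StrictlyIncreasing g
increasing-resp f≗g f↑ i j i<j = subst₂ (λ x y → toℕ x < toℕ y) (f≗g i) (f≗g j) (f↑ i j i<j)

contains? : (A : Matrix01 m n) (M : Matrix01 r c) → Dec (Contains A M)
contains? A M =
  Π-searchable (λ _ → refl) Fin-searchable _
    (λ f → Π-searchable (λ _ → refl) Fin-searchable _
      (λ g → increasing? f ×-dec increasing? g ×-dec
             all? (λ i → all? (λ j → (M i j Boolₚ.≟ true) →-dec (A (f i) (g j) Boolₚ.≟ true))))
      (λ g≗g' (f↑ , g↑ , ones) →
         f↑ , increasing-resp g≗g' g↑ , λ i j Mij → subst (λ y → A (f i) y ≡ true) (g≗g' j) (ones i j Mij)))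
    (λ f≗f' (g , f↑ , g↑ , ones) →
       g , increasing-resp f≗f' f↑ , g↑ , λ i j Mij → subst (λ x → A x (g j) ≡ true) (f≗f' i) (ones i j Mij))

admissible-resp : (M : Matrix01 r c) {A A' : Matrix01 m n} →
  Pointwise (Pointwise _≡_) A A' → Admissible k A M → Admissible k A' M
admissible-resp {k = k} M {A} {A'} A≗A' (avoids , tall) =
  (λ (f , g , f↑ , g↑ , ones) →
     avoids (f , g , f↑ , g↑ , λ i j Mij → trans (A≗A' (f i) (g j)) (ones i j Mij))) ,
  λ j → subst (k ≤_) (cong sum (map-cong (λ i → cong bit (A≗A' i j)) (allFin _))) (tall j)

admissible-exists? : ∀ k m n (M : Matrix01 r c) → Dec (Σ (Matrix01 m n) λ A → Admissible k A M)
admissible-exists? k m n M =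
  Π-searchable (λ _ _ → refl) (Π-searchable (λ _ → refl) Bool-searchable) _
    (λ A → ¬? (contains? A M) ×-dec all? (λ j → k ≤? colOnes A j))
    (admissible-resp M)

greatest : (Q : ℕ → Set) → (∀ n → Dec (Q n)) → Q n → ∀ t → (∀ n → Q n → n ≤ t) →
  Σ ℕ λ e → Q e × (∀ n → Q n → n ≤ e)
greatest Q Q? qN t bounded with Q? t
... | yes qt = t , qt , bounded
greatest Q Q? qN zero    bounded | no ¬qt = contradiction (subst Q (n≤0⇒n≡0 (bounded _ qN)) qN) ¬qt
greatest Q Q? qN (suc t) bounded | no ¬qt =
  greatest Q Q? qN t (λ n qn → s≤s⁻¹ (≤∧≢⇒< (bounded n qn) (λ { refl → ¬qt qn })))

ex-exists : ∀ k m (M : Matrix01 r c) → Σ (Matrix01 m n) (λ A → Admissible k A M) →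
  (t : ℕ) → (∀ n (A : Matrix01 m n) → Admissible k A M → n ≤ t) → Σ ℕ (IsEx k m M)
ex-exists k m M witness t bounded
  with greatest _ (λ n → admissible-exists? k m n M) witness t (λ n (A , adm) → bounded n A adm)
... | e , attained , maximal = e , attained , λ n A adm → maximal n (A , adm)

evalℤ : (Fin n → ℤ) → ℤ → ℤ
evalℤ {zero}  a t = 0ℤ
evalℤ {suc n} a t = a zero ℤ.+ t ℤ.* evalℤ (a ∘ suc) t

evalℕ : (Fin n → ℕ) → ℕ → ℕ
evalℕ {zero}  a t = 0
evalℕ {suc n} a t = a zero + t * evalℕ (a ∘ suc) t

-- Synthetic division: the quotient of a polynomial by (t - x).
quotient : ℤ → (Fin (suc n) → ℤ) → Fin n → ℤ
quotient {suc n} x a zero    = evalℤ (a ∘ suc) x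
quotient {suc n} x a (suc i) = quotient x (a ∘ suc) i

remainder-theorem : ∀ x (a : Fin (suc n) → ℤ) t →
  evalℤ a t ≡ (t ℤ.- x) ℤ.* evalℤ (quotient x a) t ℤ.+ evalℤ a x
remainder-theorem {zero} x a t = constant (a zero) t x
  where
  constant : ∀ c t x → c ℤ.+ t ℤ.* 0ℤ ≡ (t ℤ.- x) ℤ.* 0ℤ ℤ.+ (c ℤ.+ x ℤ.* 0ℤ)
  constant = solve-∀
remainder-theorem {suc n} x a t = begin
  a zero ℤ.+ t ℤ.* evalℤ (a ∘ suc) t
    ≡⟨ cong (λ e → a zero ℤ.+ t ℤ.* e) (remainder-theorem x (a ∘ suc) t) ⟩
  a zero ℤ.+ t ℤ.* ((t ℤ.- x) ℤ.* evalℤ (quotient x (a ∘ suc)) t ℤ.+ evalℤ (a ∘ suc) x)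
    ≡⟨ horner-step (a zero) t x (evalℤ (quotient x (a ∘ suc)) t) (evalℤ (a ∘ suc) x) ⟩
  (t ℤ.- x) ℤ.* (evalℤ (a ∘ suc) x ℤ.+ t ℤ.* evalℤ (quotient x (a ∘ suc)) t)
    ℤ.+ (a zero ℤ.+ x ℤ.* evalℤ (a ∘ suc) x) ∎
  where
  open ≡-Reasoning
  horner-step : ∀ c t x q r → c ℤ.+ t ℤ.* ((t ℤ.- x) ℤ.* q ℤ.+ r)
                              ≡ (t ℤ.- x) ℤ.* (r ℤ.+ t ℤ.* q) ℤ.+ (c ℤ.+ x ℤ.* r)
  horner-step = solve-∀

head-zero : ∀ x (a : Fin (suc n) → ℤ) → evalℤ (a ∘ suc) x ≡ 0ℤ → evalℤ a x ≡ 0ℤ → a zero ≡ 0ℤ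
head-zero x a tail≡0 a≡0 = begin
  a zero                               ≡⟨ sym (ℤ.+-identityʳ (a zero)) ⟩
  a zero ℤ.+ 0ℤ                        ≡⟨ cong (λ e → a zero ℤ.+ e) (sym (ℤ.*-zeroʳ x)) ⟩
  a zero ℤ.+ x ℤ.* 0ℤ                  ≡⟨ cong (λ e → a zero ℤ.+ x ℤ.* e) (sym tail≡0) ⟩
  a zero ℤ.+ x ℤ.* evalℤ (a ∘ suc) x   ≡⟨ a≡0 ⟩
  0ℤ                                   ∎
  where open ≡-Reasoning

zero-coefficients : ∀ x (a : Fin (suc n) → ℤ) → (∀ i → quotient x a i ≡ 0ℤ) →
  evalℤ a x ≡ 0ℤ → ∀ i → a i ≡ 0ℤ
zero-coefficients {zero}  x a _   a≡0 zero    = head-zero x a refl a≡0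
zero-coefficients {suc n} x a q≡0 a≡0 zero    = head-zero x a (q≡0 zero) a≡0
zero-coefficients {suc n} x a q≡0 a≡0 (suc i) = zero-coefficients x (a ∘ suc) (q≡0 ∘ suc) (q≡0 zero) i

quotient-root : ∀ x (a : Fin (suc n) → ℤ) → evalℤ a x ≡ 0ℤ →
  ∀ t → t ≢ x → evalℤ a t ≡ 0ℤ → evalℤ (quotient x a) t ≡ 0ℤ
quotient-root x a ax≡0 t t≢x at≡0
  with ℤ.i*j≡0⇒i≡0∨j≡0 (t ℤ.- x) product≡0
  where
  product≡0 : (t ℤ.- x) ℤ.* evalℤ (quotient x a) t ≡ 0ℤ
  product≡0 = begin
    (t ℤ.- x) ℤ.* evalℤ (quotient x a) t              ≡⟨ sym (ℤ.+-identityʳ _) ⟩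
    (t ℤ.- x) ℤ.* evalℤ (quotient x a) t ℤ.+ 0ℤ       ≡⟨ cong (λ e → (t ℤ.- x) ℤ.* evalℤ (quotient x a) t ℤ.+ e) (sym ax≡0) ⟩
    (t ℤ.- x) ℤ.* evalℤ (quotient x a) t ℤ.+ evalℤ a x ≡⟨ sym (remainder-theorem x a t) ⟩
    evalℤ a t                                          ≡⟨ at≡0 ⟩
    0ℤ                                                 ∎
    where open ≡-Reasoning
... | inj₁ t-x≡0 = contradiction (ℤ.i-j≡0⇒i≡j t x t-x≡0) t≢x
... | inj₂ q≡0   = q≡0

roots⇒zero : (a : Fin n → ℤ) (xs : Fin n → ℤ) → Injective _≡_ _≡_ xs →
  (∀ i → evalℤ a (xs i) ≡ 0ℤ) → ∀ i → a i ≡ 0ℤ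
roots⇒zero {zero}  a xs xs-inj roots ()
roots⇒zero {suc n} a xs xs-inj roots =
  zero-coefficients x a
    (roots⇒zero (quotient x a) (xs ∘ suc) (suc-injective ∘ xs-inj)
      (λ i → quotient-root x a (roots zero) (xs (suc i)) (λ eq → 0≢1+n (sym (xs-inj eq))) (roots (suc i))))
    (roots zero)
  where
  x : ℤ
  x = xs zero

evalℕ-ℤ : (a : Fin n → ℕ) (t : ℕ) → + evalℕ a t ≡ evalℤ (+_ ∘ a) (+ t)
evalℕ-ℤ {zero}  a t = refl
evalℕ-ℤ {suc n} a t = begin
  + (a zero + t * evalℕ (a ∘ suc) t)           ≡⟨ ℤ.pos-+ (a zero) _ ⟩
  + a zero ℤ.+ + (t * evalℕ (a ∘ suc) t)       ≡⟨ cong (λ e → + a zero ℤ.+ e) (ℤ.pos-* t _) ⟩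
  + a zero ℤ.+ + t ℤ.* + evalℕ (a ∘ suc) t     ≡⟨ cong (λ e → + a zero ℤ.+ + t ℤ.* e) (evalℕ-ℤ (a ∘ suc) t) ⟩
  + a zero ℤ.+ + t ℤ.* evalℤ (+_ ∘ a ∘ suc) (+ t) ∎
  where open ≡-Reasoning

evalℤ-difference : (a b : Fin n → ℤ) (t : ℤ) →
  evalℤ (λ i → a i ℤ.- b i) t ≡ evalℤ a t ℤ.- evalℤ b t
evalℤ-difference {zero}  a b t = refl
evalℤ-difference {suc n} a b t = begin
  (a zero ℤ.- b zero) ℤ.+ t ℤ.* evalℤ (λ i → a (suc i) ℤ.- b (suc i)) t
    ≡⟨ cong (λ e → (a zero ℤ.- b zero) ℤ.+ t ℤ.* e) (evalℤ-difference (a ∘ suc) (b ∘ suc) t) ⟩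
  (a zero ℤ.- b zero) ℤ.+ t ℤ.* (evalℤ (a ∘ suc) t ℤ.- evalℤ (b ∘ suc) t)
    ≡⟨ linear (a zero) (b zero) t (evalℤ (a ∘ suc) t) (evalℤ (b ∘ suc) t) ⟩
  (a zero ℤ.+ t ℤ.* evalℤ (a ∘ suc) t) ℤ.- (b zero ℤ.+ t ℤ.* evalℤ (b ∘ suc) t) ∎
  where
  open ≡-Reasoning
  linear : ∀ a b t x y → (a ℤ.- b) ℤ.+ t ℤ.* (x ℤ.- y) ≡ (a ℤ.+ t ℤ.* x) ℤ.- (b ℤ.+ t ℤ.* y)
  linear = solve-∀

interpolation-unique : (a b : Fin n → ℕ) (xs : Fin n → ℕ) → Injective _≡_ _≡_ xs →
  (∀ i → evalℕ a (xs i) ≡ evalℕ b (xs i)) → ∀ i → a i ≡ b i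
interpolation-unique a b xs xs-inj agree i =
  ℤ.+-injective (ℤ.i-j≡0⇒i≡j _ _ (roots⇒zero difference (+_ ∘ xs) (xs-inj ∘ ℤ.+-injective) root i))
  where
  difference : Fin _ → ℤ
  difference i = + a i ℤ.- + b i
  root : ∀ i → evalℤ difference (+ xs i) ≡ 0ℤ
  root i = begin
    evalℤ difference (+ xs i)                              ≡⟨ evalℤ-difference (+_ ∘ a) (+_ ∘ b) (+ xs i) ⟩
    evalℤ (+_ ∘ a) (+ xs i) ℤ.- evalℤ (+_ ∘ b) (+ xs i)    ≡⟨ cong₂ ℤ._-_ (sym (evalℕ-ℤ a (xs i))) (sym (evalℕ-ℤ b (xs i))) ⟩
    + evalℕ a (xs i) ℤ.- + evalℕ b (xs i)                  ≡⟨ ℤ.i≡j⇒i-j≡0 (cong +_ (agree i)) ⟩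
    0ℤ                                                     ∎
    where open ≡-Reasoning

evalℕ-bound : ∀ {q k t} .{{_ : NonZero q}} (a : Fin n → ℕ) → (∀ i → a i < q) → t < k →
  evalℕ a t < q * k ^ n
evalℕ-bound {zero}  {q} a a<q t<k = subst (0 <_) (sym (*-identityʳ q)) (>-nonZero⁻¹ q)
evalℕ-bound {suc n} {q} {k} {t} a a<q t<k = begin-strict
  a zero + t * evalℕ (a ∘ suc) t  <⟨ +-monoˡ-< _ (a<q zero) ⟩
  q + t * evalℕ (a ∘ suc) t        ≤⟨ +-mono-≤ q≤qkⁿ (*-monoʳ-≤ t (<⇒≤ (evalℕ-bound (a ∘ suc) (a<q ∘ suc) t<k))) ⟩
  q * k ^ n + t * (q * k ^ n)      ≤⟨ *-monoˡ-≤ (q * k ^ n) t<k ⟩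
  k * (q * k ^ n)                  ≡⟨ x∙yz≈y∙xz k q (k ^ n) ⟩
  q * (k * k ^ n)                  ∎
  where
  open ≤-Reasoning
  q≤qkⁿ : q ≤ q * k ^ n
  q≤qkⁿ = m≤m*n q (k ^ n) {{m^n≢0 k n {{>-nonZero (≤-<-trans z≤n t<k)}}}}

funToFin-cong : ∀ {m n} {f g : Fin m → Fin n} → (∀ i → f i ≡ g i) → funToFin f ≡ funToFin g
funToFin-cong {zero}  f≗g = refl
funToFin-cong {suc m} f≗g = cong₂ combine (f≗g zero) (funToFin-cong (f≗g ∘ suc))

divMod-injective : ∀ {x y} S .{{_ : NonZero S}} → x % S ≡ y % S → x / S ≡ y / S → x ≡ y
divMod-injective {x} {y} S %≡ /≡ = begin
  x                    ≡⟨ m≡m%n+[m/n]*n x S ⟩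
  x % S + (x / S) * S  ≡⟨ cong₂ (λ u v → u + v * S) %≡ /≡ ⟩
  y % S + (y / S) * S  ≡⟨ sym (m≡m%n+[m/n]*n y S) ⟩
  y                    ∎
  where open ≡-Reasoning

-- The lower-bound construction (a Reed–Solomon-type code).  Columns are the
-- polynomials with r coefficients in [0, q); the rows are cut into blocks of
-- size S, and column a has a one in row t·S + v exactly when v = a(t).  Each
-- column meets the first k blocks (k ≤ m / S), so it has k ones, and since two
-- distinct polynomials agree in fewer than r points, no two columns share r ones.
module PolynomialCode (m q k r S : ℕ) .{{_ : NonZero S}}
  (value<S : ∀ (a : Fin r → ℕ) → (∀ i → a i < q) → ∀ {t} → t < k → evalℕ a t < S)
  (kS≤m : k * S ≤ m) where

  -- Column col is the polynomial whose coefficients are the base-q digits of col.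
  coefficients : Fin (q ^ r) → Fin r → ℕ
  coefficients col = toℕ ∘ finToFun {q} {r} col

  coefficients-injective : ∀ {col col'} → (∀ i → coefficients col i ≡ coefficients col' i) → col ≡ col'
  coefficients-injective {col} {col'} same = begin
    col                                 ≡⟨ sym (funToFin-finToFin {r} {q} col) ⟩
    funToFin (finToFun {q} {r} col)     ≡⟨ funToFin-cong (toℕ-injective ∘ same) ⟩
    funToFin (finToFun {q} {r} col')    ≡⟨ funToFin-finToFin {r} {q} col' ⟩
    col'                                ∎
    where open ≡-Reasoning

  value : Fin (q ^ r) → ℕ → ℕ
  value col = evalℕ (coefficients col)

  -- Row ρ lies in block ρ / S at offset ρ % S.
  code : Matrix01 m (q ^ r)
  code ρ col = does (toℕ ρ % S ℕ.≟ value col (toℕ ρ / S))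

  -- Two columns sharing ones in r rows agree at the r distinct blocks of these
  -- rows, hence are equal; so the code avoids every P r c with c ≥ 2.
  code-avoids : ∀ {c} → 2 ≤ c → Avoids code (P r c)
  code-avoids (s≤s (s≤s _)) (f , g , f↑ , g↑ , ones) =
    <-irrefl (cong toℕ same-column) (g↑ zero (suc zero) z<s)
    where
    block : Fin r → ℕ
    block s = toℕ (f s) / S

    on-graph : ∀ j s → toℕ (f s) % S ≡ value (g j) (block s)
    on-graph j s = sound (_ ℕ.≟ _) (ones s j refl)

    block-injective : ∀ {s s'} → block s ≡ block s' → s ≡ s'
    block-injective {s} {s'} eq = increasing-injective f f↑ s s'
      (divMod-injective S (trans (on-graph zero s) (trans (cong (value (g zero)) eq) (sym (on-graph zero s')))) eq)

    same-column : g zero ≡ g (suc zero)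
    same-column = coefficients-injective
      (interpolation-unique _ _ block block-injective (λ s → trans (sym (on-graph zero s)) (on-graph (suc zero) s)))

  row : Fin (q ^ r) → Fin k → ℕ
  row col t = value col (toℕ t) + toℕ t * S

  value-in-range : ∀ col (t : Fin k) → value col (toℕ t) < S
  value-in-range col t = value<S _ (λ i → toℕ<n (finToFun col i)) (toℕ<n t)

  row-block : ∀ col t → row col t / S ≡ toℕ t
  row-block col t = begin
    (value col (toℕ t) + toℕ t * S) / S    ≡⟨ +-distrib-/-∣ʳ _ (n∣m*n (toℕ t)) ⟩
    value col (toℕ t) / S + toℕ t * S / S  ≡⟨ cong₂ _+_ (m<n⇒m/n≡0 (value-in-range col t)) (m*n/n≡m (toℕ t) S) ⟩
    toℕ t                                  ∎
    where open ≡-Reasoning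

  row-offset : ∀ col t → row col t % S ≡ value col (toℕ t)
  row-offset col t = trans ([m+kn]%n≡m%n _ (toℕ t) S) (m<n⇒m%n≡m (value-in-range col t))

  row<next-block : ∀ col t → row col t < suc (toℕ t) * S
  row<next-block col t = +-monoˡ-< (toℕ t * S) (value-in-range col t)

  row<m : ∀ col t → row col t < m
  row<m col t = <-≤-trans (row<next-block col t) (≤-trans (*-monoˡ-≤ S (toℕ<n t)) kS≤m)

  rowIndex : Fin (q ^ r) → Fin k → Fin m
  rowIndex col t = fromℕ< (row<m col t)

  rowIndex-increasing : ∀ col → StrictlyIncreasing (rowIndex col)
  rowIndex-increasing col t t' t<t' = subst₂ _<_ (sym (toℕ-fromℕ< _)) (sym (toℕ-fromℕ< _))
    (<-≤-trans (row<next-block col t) (≤-trans (*-monoˡ-≤ S t<t') (m≤n+m _ _)))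

  rowIndex-one : ∀ col t → code (rowIndex col t) col ≡ true
  rowIndex-one col t rewrite toℕ-fromℕ< (row<m col t) | row-block col t =
    dec-true (_ ℕ.≟ _) (row-offset col t)

  code-admissible : ∀ {c} → 2 ≤ c → Admissible k code (P r c)
  code-admissible 2≤c = code-avoids 2≤c , λ col →
    subst (k ≤_) (sym (colOnes≡count code col))
      (count-≥ (λ ρ → code ρ col) (rowIndex col) (rowIndex-increasing col) (rowIndex-one col))

*-^ : ∀ x y n → (x * y) ^ n ≡ x ^ n * y ^ n
*-^ x y zero    = refl
*-^ x y (suc n) = trans (cong (x * y *_) (*-^ x y n)) ([m*n]*[o*p]≡[m*o]*[n*p] x y (x ^ n) (y ^ n))

-- Rounding m down to a multiple of B ≤ m loses at most a factor 2, so
-- m ^ r ≤ (2B) ^ r · (m / B) ^ r.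
power-of-quotient : ∀ m B r .{{_ : NonZero B}} → B ≤ m → m ^ r ≤ (2 * B) ^ r * (m / B) ^ r
power-of-quotient m B r B≤m = begin
  m ^ r                      ≤⟨ ^-monoˡ-≤ r m≤2Bq ⟩
  (2 * B * (m / B)) ^ r      ≡⟨ *-^ (2 * B) (m / B) r ⟩
  (2 * B) ^ r * (m / B) ^ r  ∎
  where
  open ≤-Reasoning
  m≤2Bq : m ≤ 2 * B * (m / B)
  m≤2Bq = begin
    m                          ≡⟨ m≡m%n+[m/n]*n m B ⟩
    m % B + m / B * B          ≤⟨ +-monoˡ-≤ (m / B * B) (≤-trans (m%n≤n m B) (m≤n*m B (m / B) {{>-nonZero (m≥n⇒m/n>0 B≤m)}})) ⟩
    m / B * B + m / B * B      ≡⟨ double (m / B) B ⟩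
    2 * B * (m / B)            ∎
    where
    double : ∀ x y → x * y + x * y ≡ 2 * y * x
    double = ℕ-Solver.solve-∀

-- With
-- B = k ^ (r+1) and m ≥ B, the code with q = m / B gives the lower bound
-- m ^ r ≤ (2B) ^ r · q ^ r ≤ (2B) ^ r · ex, and width-bound the upper bound
-- ex ≤ (c-1) · m ^ r; together they also make the maximum ex exist.
mainTheorem6 : (r k c : ℕ) → r ≥ 1 → k ≥ r → c ≥ 2 →
    Σ ℕ λ C₁ → Σ ℕ λ C₂ → Σ ℕ λ M₀ →
      (m : ℕ) → m ≥ M₀ →
        Σ ℕ λ e → IsEx k m (P r c) e × (m ^ r ≤ C₁ * e) × (e ≤ C₂ * m ^ r)
mainTheorem6 r k zero    _   _   ()
mainTheorem6 r k (suc c) r≥1 k≥r c≥2 = (2 * B) ^ r , c , B , bounds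
  where
  instance
    k≢0 : NonZero k
    k≢0 = >-nonZero (≤-trans r≥1 k≥r)
  B : ℕ
  B = k ^ suc r
  instance
    B≢0 : NonZero B
    B≢0 = m^n≢0 k (suc r)

  bounds : (m : ℕ) → m ≥ B →
    Σ ℕ λ e → IsEx k m (P r (suc c)) e × (m ^ r ≤ (2 * B) ^ r * e) × (e ≤ c * m ^ r)
  bounds m B≤m = conclude (ex-exists k m (P r (suc c)) (code , code-admissible c≥2) (c * m ^ r) upper)
    where
    q : ℕ
    q = m / B
    instance
      q≢0 : NonZero q
      q≢0 = >-nonZero (m≥n⇒m/n>0 B≤m)
    -- Blocks of size S = q · k ^ r hold every value, and k of them fit in m rows.
    S : ℕ
    S = q * k ^ r
    instance
      S≢0 : NonZero S
      S≢0 = m*n≢0 q (k ^ r) {{q≢0}} {{m^n≢0 k r}}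
    blocks-fit : k * S ≤ m
    blocks-fit = ≤-trans (≤-reflexive (x∙yz≈y∙xz k q (k ^ r))) (m/n*n≤m m B)
    open PolynomialCode m q k r S (λ a a<q → evalℕ-bound a a<q) blocks-fit

    upper : ∀ n (A : Matrix01 m n) → Admissible k A (P r (suc c)) → n ≤ c * m ^ r
    upper _ = width-bound k≥r

    conclude : Σ ℕ (IsEx k m (P r (suc c))) →
      Σ ℕ λ e → IsEx k m (P r (suc c)) e × (m ^ r ≤ (2 * B) ^ r * e) × (e ≤ c * m ^ r)
    conclude (e , isEx@((A , admissible) , maximal)) =
      e , isEx ,
      ≤-trans (power-of-quotient m B r B≤m) (*-monoʳ-≤ ((2 * B) ^ r) (maximal (q ^ r) code (code-admissible c≥2))) ,
      upper e A admissible
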